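{- Let $n\geq 3$. For every smooth arithmetical structure on $D_n$, writing $b=\min\{\bar r_x,\bar r_y\}$, we have $2\leq b\leq 2n-4$.
   Context: For $n\ge 3$ let $\ell=n-3$. The bident $D_n$ has vertices $v_x,v_y,v_0,\dots,v_\ell$ and edges $v_xv_0$, $v_yv_0$, $v_iv_{i+1}$ ($0\le i\le\ell-1$). An arithmetical structure on $D_n$ is a pair $(\mathbf d,\mathbf r)$, $\mathbf d=(d_x,d_y,d_0,\dots,d_\ell)$, $\mathbf r=(r_x,r_y,r_0,\dots,r_\ell)$, of positive integer vectors with $(\operatorname{diag}(\mathbf d)-A)\mathbf r=\mathbf 0$ ($A$ the adjacency matrix) and $\mathbf r$ primitive. It is smooth if $d_x,d_y,d_1,\dots,d_\ell\ge2$. For such a structure, $\bar{\mathbf r}=\frac{r_0}{r_xr_y}\mathbf r$. -}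

module Defs where

open import Data.Nat using (ℕ; zero; suc; _+_; _*_; _∸_; _≤_; _≡ᵇ_)
open import Data.Nat.Divisibility using (_∣_)
open import Data.Fin using (Fin; toℕ)
import Data.Fin as Fin
open import Data.Bool using (Bool; true; false; if_then_else_; _∨_)
open import Data.List using (List; _∷_; map; allFin)
open import Data.Nat.ListAction using (sum)
open import Data.Integer using (+_)
open import Data.Rational using (ℚ; _/_; _⊓_)
open import Relation.Binary.PropositionalEquality using (_≡_)
open import Data.Product using (_×_)

-- Vertices of the bident D_n with ℓ = n - 3:
-- vx, vy and the path vertices v_0, …, v_ℓ  (vp i for i : Fin (suc ℓ)).
data V (ℓ : ℕ) : Set where
  vx : V ℓ
  vy : V ℓ
  vp : Fin (suc ℓ) → V ℓ

allV : (ℓ : ℕ) → List (V ℓ)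
allV ℓ = vx ∷ vy ∷ map vp (allFin (suc ℓ))

isZero : ∀ {k} → Fin k → Bool
isZero Fin.zero = true
isZero (Fin.suc _) = false

adj : ∀ {ℓ} → V ℓ → V ℓ → Bool
adj vx (vp i) = isZero i
adj (vp i) vx = isZero i
adj vy (vp i) = isZero i
adj (vp i) vy = isZero i
adj (vp i) (vp j) = (suc (toℕ i) ≡ᵇ toℕ j) ∨ (suc (toℕ j) ≡ᵇ toℕ i)
adj _ _ = false

A : ∀ {ℓ} → V ℓ → V ℓ → ℕ
A v w = if adj v w then 1 else 0

Ar : (ℓ : ℕ) → (V ℓ → ℕ) → V ℓ → ℕ
Ar ℓ r v = sum (map (λ w → A v w * r w) (allV ℓ))

Primitive : ∀ {ℓ} → (V ℓ → ℕ) → Set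
Primitive {ℓ} r = ∀ k → (∀ v → k ∣ r v) → k ≡ 1

record IsArithmetical (ℓ : ℕ) (d r : V ℓ → ℕ) : Set where
  field
    d-pos : ∀ v → 1 ≤ d v
    r-pos : ∀ v → 1 ≤ r v
    balance : ∀ v → d v * r v ≡ Ar ℓ r v
    r-primitive : Primitive r

IsSmooth : (ℓ : ℕ) → (V ℓ → ℕ) → Set
IsSmooth ℓ d = (2 ≤ d vx) × (2 ≤ d vy) × (∀ (i : Fin (suc ℓ)) → 1 ≤ toℕ i → 2 ≤ d (vp i))

-- a / b as a rational (b = 0 gives junk value 0; never used since r > 0)
frac : ℕ → ℕ → ℚ
frac a zero = + 0 / 1
frac a (suc b) = + a / suc b

rbar : ∀ {ℓ} → (V ℓ → ℕ) → V ℓ → ℚ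
rbar r v = frac (r (vp Fin.zero) * r v) (r vx * r vy)

bval : ∀ {ℓ} → (V ℓ → ℕ) → ℚ
bval r = rbar r vx ⊓ rbar r vy

-- Write r₀ for the label of the centre v₀. At the leaves d_x r_x = r₀ = d_y r_y, so
-- smoothness gives r₀ ≥ 2 r_x and r₀ ≥ 2 r_y; as r̄_x = r₀ / r_y and r̄_y = r₀ / r_x this
-- is b ≥ 2. Along the path, d_i ≥ 2 makes the labels convex, 2 r_i ≤ r_(i-1) + r_(i+1),
-- and they vanish at the fictitious vertex ℓ + 1, so r₁ ≤ ℓ r₀ / (ℓ + 1). With
-- r₀ ≤ d₀ r₀ = r_x + r_y + r₁ this gives r₀ ≤ (ℓ + 1)(r_x + r_y) ≤ 2(ℓ + 1) max(r_x, r_y),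
-- which is b ≤ 2(ℓ + 1) = 2n - 4.
module Submission where

open import Defs
open import Data.Nat using (ℕ; _∸_; _*_)
import Data.Nat as ℕ
open import Data.Integer using (+_)
open import Data.Rational using (ℚ; _/_; _≤_)
open import Data.Product using (_×_)

open import Data.Bool using (Bool; true; false; if_then_else_; _∨_; T)
open import Data.Empty using (⊥-elim)
open import Data.Fin using (Fin; toℕ; fromℕ<) renaming (zero to fzero; suc to fsuc)
open import Data.Fin.Properties using (toℕ-fromℕ<)
open import Data.List using ([]; _∷_; map; tabulate; allFin)
open import Data.List.Properties using (map-tabulate; tabulate-cong)
open import Data.Nat using (zero; suc; _+_; z≤n; s≤s; _≡ᵇ_; _≤?_)
open import Data.Nat.ListAction using (sum)
open import Data.Nat.Properties
open import Data.Nat.Tactic.RingSolver using (solve; solve-∀)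
open import Data.Product using (_,_; proj₁; proj₂)
import Data.Integer as ℤ
import Data.Integer.Properties as ℤₚ
import Data.Rational.Properties as ℚₚ
import Data.Rational.Unnormalised as ℚᵘ
import Data.Rational.Unnormalised.Properties as ℚᵘₚ
import Data.Vec.Functional as Vector
open import Function using (_∘_)
open import Relation.Binary.PropositionalEquality
open import Relation.Nullary using (¬_; yes; no)

/≤/-from-*≤* : ∀ a b c d → a * suc d ℕ.≤ c * suc b → + a / suc b ≤ + c / suc d
/≤/-from-*≤* a b c d ad≤cb = ℚₚ.toℚᵘ-cancel-≤
  (ℚᵘₚ.≤-respˡ-≃ (ℚᵘₚ.≃-sym (ℚₚ.toℚᵘ-fromℚᵘ (ℚᵘ.mkℚᵘ (+ a) b)))
    (ℚᵘₚ.≤-respʳ-≃ (ℚᵘₚ.≃-sym (ℚₚ.toℚᵘ-fromℚᵘ (ℚᵘ.mkℚᵘ (+ c) d)))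
      (ℚᵘ.*≤* (subst₂ ℤ._≤_ (ℤₚ.pos-* a (suc d)) (ℤₚ.pos-* c (suc b)) (ℤ.+≤+ ad≤cb)))))

fromℕ≤frac : ∀ K p q → 1 ℕ.≤ q → K * q ℕ.≤ p → + K / 1 ≤ frac p q
fromℕ≤frac K p (suc q) _ Kq≤p = /≤/-from-*≤* K 0 p q (subst (K * suc q ℕ.≤_) (sym (*-identityʳ p)) Kq≤p)

frac≤fromℕ : ∀ K p q → 1 ℕ.≤ q → p ℕ.≤ K * q → frac p q ≤ + K / 1
frac≤fromℕ K p (suc q) _ p≤Kq = /≤/-from-*≤* p q K 0 (subst (ℕ._≤ K * suc q) (sym (*-identityʳ p)) p≤Kq)

sum-tabulate-mono : ∀ {n} {f g : Fin n → ℕ} → (∀ j → f j ℕ.≤ g j) →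
                    sum (tabulate f) ℕ.≤ sum (tabulate g)
sum-tabulate-mono {zero}  f≤g = z≤n
sum-tabulate-mono {suc n} f≤g = +-mono-≤ (f≤g fzero) (sum-tabulate-mono (f≤g ∘ fsuc))

sum-tabulate-+ : ∀ {n} (f g : Fin n → ℕ) →
                 sum (tabulate (λ j → f j + g j)) ≡ sum (tabulate f) + sum (tabulate g)
sum-tabulate-+ {zero}  f g = refl
sum-tabulate-+ {suc n} f g = begin
  f fzero + g fzero + sum (tabulate (λ j → f (fsuc j) + g (fsuc j)))
    ≡⟨ cong (_+_ (f fzero + g fzero)) (sum-tabulate-+ (f ∘ fsuc) (g ∘ fsuc)) ⟩
  f fzero + g fzero + (sum (tabulate (f ∘ fsuc)) + sum (tabulate (g ∘ fsuc)))
    ≡⟨ +-interchange (f fzero) (g fzero) _ _ ⟩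
  f fzero + sum (tabulate (f ∘ fsuc)) + (g fzero + sum (tabulate (g ∘ fsuc))) ∎
  where open ≡-Reasoning
        open import Algebra.Properties.CommutativeSemigroup +-commutativeSemigroup
          using () renaming (interchange to +-interchange)

sum-tabulate-0 : ∀ n → sum (tabulate {n = n} (λ _ → 0)) ≡ 0
sum-tabulate-0 zero    = refl
sum-tabulate-0 (suc n) = sum-tabulate-0 n

extendByZero : ∀ {m} → (Fin m → ℕ) → ℕ → ℕ
extendByZero {zero}  g _       = 0
extendByZero {suc m} g zero    = g fzero
extendByZero {suc m} g (suc k) = extendByZero (g ∘ fsuc) k

extendByZero-toℕ : ∀ {m} (g : Fin m → ℕ) j → extendByZero g (toℕ j) ≡ g j
extendByZero-toℕ g fzero    = refl
extendByZero-toℕ g (fsuc j) = extendByZero-toℕ (g ∘ fsuc) j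

extendByZero-length : ∀ {m} (g : Fin m → ℕ) → extendByZero g m ≡ 0
extendByZero-length {zero}  g = refl
extendByZero-length {suc m} g = extendByZero-length (g ∘ fsuc)

if-≤ : ∀ b x → (if b then x else 0) ℕ.≤ x
if-≤ true  x = ≤-refl
if-≤ false x = z≤n

if-false : ∀ {b} x → ¬ T b → (if b then x else 0) ≡ 0
if-false {true}  x ¬T = ⊥-elim (¬T _)
if-false {false} x ¬T = refl

if-∨-≤ : ∀ b c x → (if b ∨ c then 1 else 0) * x ℕ.≤ (if b then x else 0) + (if c then x else 0)
if-∨-≤ true  c     x = ≤-trans (≤-reflexive (+-identityʳ x)) (m≤m+n x _)
if-∨-≤ false true  x = ≤-reflexive (+-identityʳ x)
if-∨-≤ false false x = z≤n

sum-if-none : ∀ {m} (t : Fin m → Bool) (g : Fin m → ℕ) → (∀ j → ¬ T (t j)) →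
              sum (tabulate (λ j → if t j then g j else 0)) ≡ 0
sum-if-none {m} t g none = trans (cong sum (tabulate-cong (λ j → if-false (g j) (none j)))) (sum-tabulate-0 m)

sum-if≤extendByZero : ∀ {m} (t : Fin m → Bool) (g : Fin m → ℕ) c → (∀ j → T (t j) → toℕ j ≡ c) →
                      sum (tabulate (λ j → if t j then g j else 0)) ℕ.≤ extendByZero g c
sum-if≤extendByZero {zero}  t g c       only-c = z≤n
sum-if≤extendByZero {suc m} t g zero    only-c
  rewrite sum-if-none (t ∘ fsuc) (g ∘ fsuc) (λ j tj → 0≢1+n (sym (only-c (fsuc j) tj)))
        | +-identityʳ (if t fzero then g fzero else 0)
  = if-≤ (t fzero) (g fzero)
sum-if≤extendByZero {suc m} t g (suc c) only-c
  rewrite if-false {t fzero} (g fzero) (λ t0 → 0≢1+n (only-c fzero t0))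
  = sum-if≤extendByZero (t ∘ fsuc) (g ∘ fsuc) c (λ j tj → suc-injective (only-c (fsuc j) tj))

-- extendByZero (0 ∷ g) i is the value of g at i - 1, and 0 when i = 0.
path-neighbour-sum≤ : ∀ {m} (g : Fin m → ℕ) i →
            sum (tabulate (λ j → (if (suc i ≡ᵇ toℕ j) ∨ (suc (toℕ j) ≡ᵇ i) then 1 else 0) * g j))
              ℕ.≤ extendByZero g (suc i) + extendByZero (0 Vector.∷ g) i
path-neighbour-sum≤ {m} g i = begin
  sum (tabulate (λ j → (if right j ∨ left j then 1 else 0) * g j))
    ≤⟨ sum-tabulate-mono (λ j → if-∨-≤ (right j) (left j) (g j)) ⟩
  sum (tabulate (λ j → (if right j then g j else 0) + (if left j then g j else 0)))
    ≡⟨ sum-tabulate-+ (λ j → if right j then g j else 0) (λ j → if left j then g j else 0) ⟩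
  sum (tabulate (λ j → if right j then g j else 0)) + sum (tabulate (λ j → if left j then g j else 0))
    ≤⟨ +-mono-≤ (sum-if≤extendByZero right g (suc i) (λ j e → sym (≡ᵇ⇒≡ _ _ e)))
                (sum-if≤extendByZero (false Vector.∷ left) (0 Vector.∷ g) i left-index) ⟩
  extendByZero g (suc i) + extendByZero (0 Vector.∷ g) i ∎
  where
  open ≤-Reasoning
  right left : Fin m → Bool
  right j = suc i ≡ᵇ toℕ j
  left j = suc (toℕ j) ≡ᵇ i
  left-index : ∀ j → T ((false Vector.∷ left) j) → toℕ j ≡ i
  left-index (fsuc j) e = ≡ᵇ⇒≡ _ _ e

module _ {ℓ : ℕ} (r : V ℓ → ℕ) where

  Ar-expand : ∀ v → Ar ℓ r v ≡ A v vx * r vx + (A v vy * r vy + sum (tabulate (λ j → A v (vp j) * r (vp j))))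
  Ar-expand v = cong (λ s → A v vx * r vx + (A v vy * r vy + s)) (begin
    sum (map h (map vp (allFin (suc ℓ)))) ≡⟨ cong (sum ∘ map h) (map-tabulate (λ j → j) vp) ⟩
    sum (map h (tabulate vp))             ≡⟨ cong sum (map-tabulate vp h) ⟩
    sum (tabulate (h ∘ vp))               ∎)
    where
    open ≡-Reasoning
    h : V ℓ → ℕ
    h w = A v w * r w

  sum-v₀ : sum (tabulate (λ j → (if isZero j then 1 else 0) * r (vp j))) ≡ r (vp fzero)
  sum-v₀ = trans (cong₂ _+_ (+-identityʳ _) (sum-tabulate-0 ℓ)) (+-identityʳ _)

  Ar-vx : Ar ℓ r vx ≡ r (vp fzero)
  Ar-vx = trans (Ar-expand vx) sum-v₀

  Ar-vy : Ar ℓ r vy ≡ r (vp fzero)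
  Ar-vy = trans (Ar-expand vy) sum-v₀

  Ar-vp≤ : ∀ i → Ar ℓ r (vp i) ℕ.≤
    A (vp i) vx * r vx + (A (vp i) vy * r vy
      + (extendByZero (r ∘ vp) (suc (toℕ i)) + extendByZero (0 Vector.∷ r ∘ vp) (toℕ i)))
  Ar-vp≤ i = ≤-trans (≤-reflexive (Ar-expand (vp i)))
    (+-monoʳ-≤ (A (vp i) vx * r vx) (+-monoʳ-≤ (A (vp i) vy * r vy) (path-neighbour-sum≤ (r ∘ vp) (toℕ i))))

  Ar-vp-suc≤ : ∀ j → Ar ℓ r (vp (fsuc j)) ℕ.≤
    extendByZero (r ∘ vp) (suc (suc (toℕ j))) + extendByZero (r ∘ vp) (toℕ j)
  Ar-vp-suc≤ j = Ar-vp≤ (fsuc j)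

  Ar-v₀≤ : Ar ℓ r (vp fzero) ℕ.≤ r vx + r vy + extendByZero (r ∘ vp) 1
  Ar-v₀≤ = ≤-trans (Ar-vp≤ fzero) (≤-reflexive (rearrange (r vx) (r vy) _))
    where
    rearrange : ∀ a b c → 1 * a + (1 * b + (c + 0)) ≡ a + b + c
    rearrange = solve-∀

convex-decay : ∀ (f : ℕ → ℕ) ℓ → f (suc ℓ) ≡ 0 →
               (∀ k → k ℕ.< ℓ → 2 * f (suc k) ℕ.≤ f (suc (suc k)) + f k) →
               suc ℓ * f 1 ℕ.≤ ℓ * f 0
convex-decay f ℓ f[1+ℓ]≡0 convex = slope ℓ 0 (+-identityʳ ℓ)
  where
  slope-step : ∀ t x y z → suc t * z ℕ.≤ t * y → 2 * y ℕ.≤ z + x → suc (suc t) * y ℕ.≤ suc t * x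
  slope-step t x y z tz≤ty 2y≤z+x = +-cancelˡ-≤ (t * y) _ _ (begin
    t * y + suc (suc t) * y ≡⟨ solve (t ∷ y ∷ []) ⟩
    suc t * (2 * y)         ≤⟨ *-monoʳ-≤ (suc t) 2y≤z+x ⟩
    suc t * (z + x)         ≡⟨ *-distribˡ-+ (suc t) z x ⟩
    suc t * z + suc t * x   ≤⟨ +-monoˡ-≤ (suc t * x) tz≤ty ⟩
    t * y + suc t * x       ∎)
    where open ≤-Reasoning

  slope : ∀ t b → t + b ≡ ℓ → suc t * f (suc b) ℕ.≤ t * f b
  slope zero    b refl     = ≤-reflexive (trans (+-identityʳ _) f[1+ℓ]≡0)
  slope (suc t) b 1+t+b≡ℓ  = slope-step t (f b) (f (suc b)) (f (suc (suc b)))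
    (slope t (suc b) (trans (+-suc t b) 1+t+b≡ℓ))
    (convex b (subst (suc b ℕ.≤_) 1+t+b≡ℓ (s≤s (m≤n+m b t))))

≤-from-slope : ∀ l x s e → suc l * e ℕ.≤ l * x → x ℕ.≤ s + e → x ℕ.≤ suc l * s
≤-from-slope l x s e le≤lx x≤s+e = +-cancelʳ-≤ (l * x) _ _ (begin
  x + l * x             ≡⟨⟩
  suc l * x             ≤⟨ *-monoʳ-≤ (suc l) x≤s+e ⟩
  suc l * (s + e)       ≡⟨ *-distribˡ-+ (suc l) s e ⟩
  suc l * s + suc l * e ≤⟨ +-monoʳ-≤ (suc l * s) le≤lx ⟩
  suc l * s + l * x     ∎)
  where open ≤-Reasoning

m*[x+y]≤2*m*y : ∀ m {x y} → x ℕ.≤ y → m * (x + y) ℕ.≤ 2 * m * y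
m*[x+y]≤2*m*y m {x} {y} x≤y = begin
  m * (x + y) ≤⟨ *-monoʳ-≤ m (+-monoˡ-≤ y x≤y) ⟩
  m * (y + y) ≡⟨ solve (m ∷ y ∷ []) ⟩
  2 * m * y   ∎
  where open ≤-Reasoning

module SmoothArithmetical {ℓ : ℕ} {d r : V ℓ → ℕ} (arith : IsArithmetical ℓ d r) (smooth : IsSmooth ℓ d) where
  open IsArithmetical arith
  open ≤-Reasoning

  r₀ rx ry : ℕ
  r₀ = r (vp fzero)
  rx = r vx
  ry = r vy

  -- ρ k is the label of v_k, and 0 for k > ℓ: the balance at v_ℓ then has the same
  -- shape as at the other inner path vertices.
  ρ : ℕ → ℕ
  ρ = extendByZero (r ∘ vp)

  2*r≤Ar : ∀ v → 2 ℕ.≤ d v → 2 * r v ℕ.≤ Ar ℓ r v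
  2*r≤Ar v 2≤d = ≤-trans (*-monoˡ-≤ (r v) 2≤d) (≤-reflexive (balance v))

  2*rx≤r₀ : 2 * rx ℕ.≤ r₀
  2*rx≤r₀ = ≤-trans (2*r≤Ar vx (proj₁ smooth)) (≤-reflexive (Ar-vx r))

  2*ry≤r₀ : 2 * ry ℕ.≤ r₀
  2*ry≤r₀ = ≤-trans (2*r≤Ar vy (proj₁ (proj₂ smooth))) (≤-reflexive (Ar-vy r))

  r₀≤rx+ry+ρ₁ : r₀ ℕ.≤ rx + ry + ρ 1
  r₀≤rx+ry+ρ₁ = begin
    r₀                                ≡⟨ sym (*-identityˡ r₀) ⟩
    1 * r₀                            ≤⟨ *-monoˡ-≤ r₀ (d-pos (vp fzero)) ⟩
    d (vp fzero) * r₀                 ≡⟨ balance (vp fzero) ⟩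
    Ar ℓ r (vp fzero)                 ≤⟨ Ar-v₀≤ r ⟩
    rx + ry + ρ 1                     ∎

  ρ-convex : ∀ k → k ℕ.< ℓ → 2 * ρ (suc k) ℕ.≤ ρ (suc (suc k)) + ρ k
  ρ-convex k k<ℓ = subst (λ m → 2 * ρ (suc m) ℕ.≤ ρ (suc (suc m)) + ρ m) (toℕ-fromℕ< k<ℓ) (at (fromℕ< k<ℓ))
    where
    at : ∀ j → 2 * ρ (suc (toℕ j)) ℕ.≤ ρ (suc (suc (toℕ j))) + ρ (toℕ j)
    at j = begin
      2 * ρ (suc (toℕ j))                 ≡⟨ cong (2 *_) (extendByZero-toℕ (r ∘ vp) (fsuc j)) ⟩
      2 * r (vp (fsuc j))                 ≤⟨ 2*r≤Ar (vp (fsuc j)) (proj₂ (proj₂ smooth) (fsuc j) (s≤s z≤n)) ⟩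
      Ar ℓ r (vp (fsuc j))                ≤⟨ Ar-vp-suc≤ r j ⟩
      ρ (suc (suc (toℕ j))) + ρ (toℕ j)   ∎

  r₀≤[1+ℓ]*[rx+ry] : r₀ ℕ.≤ suc ℓ * (rx + ry)
  r₀≤[1+ℓ]*[rx+ry] = ≤-from-slope ℓ r₀ (rx + ry) (ρ 1)
    (convex-decay ρ ℓ (extendByZero-length (r ∘ vp)) ρ-convex) r₀≤rx+ry+ρ₁

  1≤rx*ry : 1 ℕ.≤ rx * ry
  1≤rx*ry = *-mono-≤ (r-pos vx) (r-pos vy)

  K≤rbar-vx : ∀ K → K * ry ℕ.≤ r₀ → + K / 1 ≤ rbar r vx
  K≤rbar-vx K Kry≤r₀ = fromℕ≤frac K (r₀ * rx) (rx * ry) 1≤rx*ry (begin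
    K * (rx * ry) ≡⟨ cong (K *_) (*-comm rx ry) ⟩
    K * (ry * rx) ≡⟨ *-assoc K ry rx ⟨
    K * ry * rx   ≤⟨ *-monoˡ-≤ rx Kry≤r₀ ⟩
    r₀ * rx       ∎)

  K≤rbar-vy : ∀ K → K * rx ℕ.≤ r₀ → + K / 1 ≤ rbar r vy
  K≤rbar-vy K Krx≤r₀ = fromℕ≤frac K (r₀ * ry) (rx * ry) 1≤rx*ry (begin
    K * (rx * ry) ≡⟨ *-assoc K rx ry ⟨
    K * rx * ry   ≤⟨ *-monoˡ-≤ ry Krx≤r₀ ⟩
    r₀ * ry       ∎)

  rbar-vx≤K : ∀ K → r₀ ℕ.≤ K * ry → rbar r vx ≤ + K / 1
  rbar-vx≤K K r₀≤Kry = frac≤fromℕ K (r₀ * rx) (rx * ry) 1≤rx*ry (begin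
    r₀ * rx       ≤⟨ *-monoˡ-≤ rx r₀≤Kry ⟩
    K * ry * rx   ≡⟨ *-assoc K ry rx ⟩
    K * (ry * rx) ≡⟨ cong (K *_) (*-comm ry rx) ⟩
    K * (rx * ry) ∎)

  rbar-vy≤K : ∀ K → r₀ ℕ.≤ K * rx → rbar r vy ≤ + K / 1
  rbar-vy≤K K r₀≤Krx = frac≤fromℕ K (r₀ * ry) (rx * ry) 1≤rx*ry (begin
    r₀ * ry       ≤⟨ *-monoˡ-≤ ry r₀≤Krx ⟩
    K * rx * ry   ≡⟨ *-assoc K rx ry ⟩
    K * (rx * ry) ∎)

  2≤bval : + 2 / 1 ≤ bval r
  2≤bval = ℚₚ.⊓-glb (K≤rbar-vx 2 2*ry≤r₀) (K≤rbar-vy 2 2*rx≤r₀)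

  bval≤2*[1+ℓ] : bval r ≤ + (2 * suc ℓ) / 1
  bval≤2*[1+ℓ] with rx ℕ.≤? ry
  ... | yes rx≤ry = ℚₚ.≤-trans (ℚₚ.p⊓q≤p (rbar r vx) (rbar r vy)) (rbar-vx≤K (2 * suc ℓ)
    (≤-trans r₀≤[1+ℓ]*[rx+ry] (m*[x+y]≤2*m*y (suc ℓ) rx≤ry)))
  ... | no rx≰ry = ℚₚ.≤-trans (ℚₚ.p⊓q≤q (rbar r vx) (rbar r vy)) (rbar-vy≤K (2 * suc ℓ)
    (≤-trans r₀≤[1+ℓ]*[rx+ry] (subst (ℕ._≤ 2 * suc ℓ * rx) (cong (suc ℓ *_) (+-comm ry rx))
      (m*[x+y]≤2*m*y (suc ℓ) (≰⇒≥ rx≰ry)))))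

2*[3+ℓ]∸4≡2*[1+ℓ] : ∀ ℓ → 2 * (3 + ℓ) ∸ 4 ≡ 2 * suc ℓ
2*[3+ℓ]∸4≡2*[1+ℓ] ℓ = trans (cong (_∸ 4) (*-distribˡ-+ 2 3 ℓ)) (sym (*-suc 2 ℓ))

proposition3p6 : (n : ℕ) → 3 ℕ.≤ n → (d r : V (n ∸ 3) → ℕ)
    → IsArithmetical (n ∸ 3) d r → IsSmooth (n ∸ 3) d
    → ((+ 2 / 1) ≤ bval r) × (bval r ≤ (+ (2 * n ∸ 4) / 1))
proposition3p6 (suc (suc (suc ℓ))) (s≤s (s≤s (s≤s z≤n))) d r arith smooth
  rewrite 2*[3+ℓ]∸4≡2*[1+ℓ] ℓ = 2≤bval , bval≤2*[1+ℓ]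
  where open SmoothArithmetical arith smooth
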